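{- Let $G$ be a finite undirected graph with vertex set $\{v_1,\ldots,v_n\}$. Then the number of maximal clique-partitions of $G$ is at most $\prod_{i=1}^n d(v_i)$.
   Context: A clique of $G$ is a nonempty set of pairwise adjacent vertices; it is maximal if it is not a proper subset of another clique. For a vertex $v$, $d(v)$ denotes the number of maximal cliques of $G$ that contain $v$. A clique-partition of $G$ is a partition of the vertex set into cliques; it is maximal if it does not contain two different cliques $C,C'$ such that $C\cup C'$ is a clique. -}

module Defs where

open import Data.Nat using (ℕ; zero; suc; _*_)
open import Data.Fin using (Fin; zero; suc)
open import Data.Fin.Subset using (Subset; _∈_; _⊆_; _⊂_; _∪_; Nonempty)
open import Data.Vec using (Vec; lookup)
open import Data.List using (List; length)
open import Data.List.Relation.Unary.Unique.Propositional using (Unique)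
import Data.List.Membership.Propositional as LM
open import Data.Product using (Σ; _×_; ∃)
open import Relation.Nullary using (¬_; Dec)
open import Relation.Binary.PropositionalEquality using (_≡_; _≢_)
open import Function.Bundles using (_⇔_)

record Graph (n : ℕ) : Set₁ where
  field
    Adj    : Fin n → Fin n → Set
    adj?   : ∀ x y → Dec (Adj x y)
    sym    : ∀ {x y} → Adj x y → Adj y x
    irrefl : ∀ {x} → ¬ Adj x x

module _ {n : ℕ} (G : Graph n) where
  open Graph G

  IsClique : Subset n → Set
  IsClique C = Nonempty C × (∀ x y → x ∈ C → y ∈ C → x ≢ y → Adj x y)

  IsMaximalClique : Subset n → Set
  IsMaximalClique C = IsClique C × (∀ C′ → IsClique C′ → ¬ (C ⊂ C′))

  -- A partition of the vertex set is encoded by its block map: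
  -- P[v] is the block containing v.  (Block maps satisfying the two
  -- conditions below are in bijection with partitions of Fin n.)
  IsPartition : Vec (Subset n) n → Set
  IsPartition P = (∀ v → v ∈ lookup P v)
                × (∀ v w → w ∈ lookup P v → lookup P w ≡ lookup P v)

  IsCliquePartition : Vec (Subset n) n → Set
  IsCliquePartition P = IsPartition P × (∀ v → IsClique (lookup P v))

  IsMaximalCliquePartition : Vec (Subset n) n → Set
  IsMaximalCliquePartition P =
    IsCliquePartition P
    × (∀ v w → lookup P v ≢ lookup P w → ¬ IsClique (lookup P v ∪ lookup P w))

HasSize : {A : Set} → (A → Set) → ℕ → Set
HasSize {A} S k =
  Σ (List A) λ L → Unique L × (∀ x → (x LM.∈ L) ⇔ S x) × length L ≡ k

prod : {n : ℕ} → (Fin n → ℕ) → ℕ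
prod {zero}  f = 1
prod {suc n} f = f zero * prod (λ i → f (suc i))

-- Every block of a maximal clique-partition extends (greedily) to a maximal
-- clique, and the extension of the block of v contains v. Two different blocks
-- never extend to the same maximal clique, since their union would then be a
-- clique; hence the choice v ↦ (maximal clique extending the block of v)
-- determines the partition. So maximal clique-partitions inject into the
-- choice functions assigning to each v one of the d(v) maximal cliques
-- containing v, of which there are ∏ d(v).
module Submission where

open import Defs
open import Data.Nat using (ℕ; zero; suc; _≤_)
open import Data.Fin using (Fin; zero; suc; combine)
open import Data.Fin.Properties using (all?; combine-injective; injective⇒≤; _≟_)
open import Data.Fin.Subset using (Subset; _∈_; _⊆_; _∪_; ⁅_⁆)
open import Data.Fin.Subset.Properties
  using (_∈?_; x∈p∪q⁺; x∈p∪q⁻; p⊆p∪q; q⊆p∪q; x∈⁅x⁆; x∈⁅y⁆⇒x≡y; ⊆-antisym)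
open import Data.Bool as Bool using ()
open import Data.Vec using (Vec; lookup; tabulate)
open import Data.Vec.Properties using (tabulate∘lookup; tabulate-cong; ≡-dec)
open import Data.List as List using (List; []; _∷_; allFin)
import Data.List.Relation.Unary.All as All
open import Data.List.Relation.Unary.AllPairs using (_∷_)
open import Data.List.Relation.Unary.Any using (here; there; index)
open import Data.List.Relation.Unary.Unique.Propositional using (Unique)
open import Data.List.Membership.Propositional using () renaming (_∈_ to _∈ₗ_)
open import Data.List.Membership.Propositional.Properties using (∈-allFin; ∈-lookup)
open import Data.List.Membership.Setoid.Properties using (index-injective)
open import Data.Product using (_×_; _,_; proj₁; proj₂)
open import Data.Sum using (_⊎_; inj₁; inj₂; map₂)
open import Relation.Nullary using (Dec; yes; no; ¬?; contradiction)
open import Relation.Nullary.Decidable using (_→-dec_)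
open import Relation.Binary.PropositionalEquality
  using (_≡_; _≢_; refl; sym; cong; subst; setoid; module ≡-Reasoning)
open import Function using (_∘_)
open import Function.Bundles using (Equivalence)

module _ {A : Set} where

  lookup-injective : {xs : List A} → Unique xs
                   → ∀ {i j} → List.lookup xs i ≡ List.lookup xs j → i ≡ j
  lookup-injective (_ ∷ _)    {zero}  {zero}  _ = refl
  lookup-injective (x∉ ∷ _)   {zero}  {suc j} e = contradiction e (All.lookup x∉ (∈-lookup j))
  lookup-injective (x∉ ∷ _)   {suc i} {zero}  e = contradiction (sym e) (All.lookup x∉ (∈-lookup i))
  lookup-injective (_ ∷ xs!)  {suc i} {suc j} e = cong suc (lookup-injective xs! e)

  module _ {S : A → Set} where

    position : ∀ {k} → HasSize S k → ∀ x → S x → Fin k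
    position (L , _ , L⇔S , refl) x sx = index (Equivalence.from (L⇔S x) sx)

    position-injective : ∀ {k} (h : HasSize S k) x y (sx : S x) (sy : S y)
                       → position h x sx ≡ position h y sy → x ≡ y
    position-injective (L , _ , L⇔S , refl) x y sx sy =
      index-injective (setoid A) (Equivalence.from (L⇔S x) sx) (Equivalence.from (L⇔S y) sy)

    HasSize-≤ : ∀ {k m} → HasSize S k
              → (f : ∀ x → S x → Fin m)
              → (∀ x y (sx : S x) (sy : S y) → f x sx ≡ f y sy → x ≡ y)
              → k ≤ m
    HasSize-≤ (L , L! , L⇔S , refl) f f-injective =
      injective⇒≤ λ {i} {j} e → lookup-injective L! (f-injective _ _ (member i) (member j) e)
      where
      member : ∀ i → S (List.lookup L i)
      member i = Equivalence.to (L⇔S _) (∈-lookup i)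

encode : ∀ {n} {d : Fin n → ℕ} → ((v : Fin n) → Fin (d v)) → Fin (prod d)
encode {zero}  t = zero
encode {suc n} t = combine (t zero) (encode (λ i → t (suc i)))

encode-injective : ∀ {n} {d : Fin n → ℕ} (t u : (v : Fin n) → Fin (d v))
                 → encode t ≡ encode u → ∀ v → t v ≡ u v
encode-injective {suc n} t u e v
  with combine-injective (t zero) (encode (λ i → t (suc i))) (u zero) (encode (λ i → u (suc i))) e
encode-injective {suc n} t u e zero    | t₀≡u₀ , _ = t₀≡u₀
encode-injective {suc n} t u e (suc v) | _ , rest =
  encode-injective (λ i → t (suc i)) (λ i → u (suc i)) rest v

module _ {n : ℕ} (G : Graph n) where
  open Graph G using (Adj; adj?) renaming (sym to Adj-sym)

  PairwiseAdjacent : Subset n → Set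
  PairwiseAdjacent S = ∀ x y → x ∈ S → y ∈ S → x ≢ y → Adj x y

  AdjacentToAll : Subset n → Fin n → Set
  AdjacentToAll S y = ∀ x → x ∈ S → x ≢ y → Adj x y

  adjacentToAll? : ∀ S y → Dec (AdjacentToAll S y)
  adjacentToAll? S y = all? λ x → (x ∈? S) →-dec (¬? (x ≟ y) →-dec adj? x y)

  pairwiseAdjacent-∪⁅⁆ : ∀ {S y} → PairwiseAdjacent S → AdjacentToAll S y
                       → PairwiseAdjacent (S ∪ ⁅ y ⁆)
  pairwiseAdjacent-∪⁅⁆ {S} {y} S-pw y-adj x z x∈ z∈ = go (cases x∈) (cases z∈)
    where
    cases : ∀ {x} → x ∈ S ∪ ⁅ y ⁆ → x ∈ S ⊎ x ≡ y
    cases x∈ = map₂ (x∈⁅y⁆⇒x≡y y) (x∈p∪q⁻ S ⁅ y ⁆ x∈)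
    go : x ∈ S ⊎ x ≡ y → z ∈ S ⊎ z ≡ y → x ≢ z → Adj x z
    go (inj₁ x∈S)  (inj₁ z∈S)  x≢z = S-pw x z x∈S z∈S x≢z
    go (inj₁ x∈S)  (inj₂ refl) x≢z = y-adj x x∈S x≢z
    go (inj₂ refl) (inj₁ z∈S)  x≢z = Adj-sym (y-adj z z∈S (λ z≡x → x≢z (sym z≡x)))
    go (inj₂ refl) (inj₂ refl) x≢z = contradiction refl x≢z

  step : Fin n → Subset n → Subset n
  step y S with adjacentToAll? S y
  ... | yes _ = S ∪ ⁅ y ⁆
  ... | no  _ = S

  ⊆-step : ∀ y S → S ⊆ step y S
  ⊆-step y S with adjacentToAll? S y
  ... | yes _ = p⊆p∪q ⁅ y ⁆
  ... | no  _ = λ x∈ → x∈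

  ∈-step : ∀ {y S} → AdjacentToAll S y → y ∈ step y S
  ∈-step {y} {S} y-adj with adjacentToAll? S y
  ... | yes _      = q⊆p∪q S ⁅ y ⁆ (x∈⁅x⁆ y)
  ... | no ¬y-adj  = contradiction y-adj ¬y-adj

  pairwiseAdjacent-step : ∀ y {S} → PairwiseAdjacent S → PairwiseAdjacent (step y S)
  pairwiseAdjacent-step y {S} S-pw with adjacentToAll? S y
  ... | yes y-adj = pairwiseAdjacent-∪⁅⁆ S-pw y-adj
  ... | no  _     = S-pw

  steps : List (Fin n) → Subset n → Subset n
  steps []       S = S
  steps (y ∷ ys) S = steps ys (step y S)

  ⊆-steps : ∀ ys S → S ⊆ steps ys S
  ⊆-steps []       S x∈ = x∈
  ⊆-steps (y ∷ ys) S x∈ = ⊆-steps ys (step y S) (⊆-step y S x∈)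

  pairwiseAdjacent-steps : ∀ ys {S} → PairwiseAdjacent S → PairwiseAdjacent (steps ys S)
  pairwiseAdjacent-steps []       S-pw = S-pw
  pairwiseAdjacent-steps (y ∷ ys) S-pw = pairwiseAdjacent-steps ys (pairwiseAdjacent-step y S-pw)

  -- Adjacency to the final set implies adjacency to the set present when y was visited.
  steps-closed : ∀ ys S {y} → y ∈ₗ ys → AdjacentToAll (steps ys S) y → y ∈ steps ys S
  steps-closed (y ∷ ys) S (here refl) y-adj =
    ⊆-steps ys (step y S) (∈-step λ x x∈S → y-adj x (⊆-steps ys (step y S) (⊆-step y S x∈S)))
  steps-closed (_ ∷ ys) S (there y∈ys) y-adj = steps-closed ys _ y∈ys y-adj

  extend : Subset n → Subset n
  extend = steps (allFin n)

  ⊆-extend : ∀ S → S ⊆ extend S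
  ⊆-extend = ⊆-steps (allFin n)

  extend-isMaximalClique : ∀ {C} → IsClique G C → IsMaximalClique G (extend C)
  extend-isMaximalClique {C} ((x , x∈C) , C-pw) =
    ((x , ⊆-extend C x∈C) , pairwiseAdjacent-steps (allFin n) C-pw) ,
    λ { C′ (_ , C′-pw) (E⊆C′ , y , y∈C′ , y∉E) →
        y∉E (steps-closed (allFin n) C (∈-allFin y)
              λ z z∈E z≢y → C′-pw z y (E⊆C′ z∈E) y∈C′ z≢y) }

  module _ (P : Vec (Subset n) n) (P-max : IsMaximalCliquePartition G P) where
    private
      block : Fin n → Subset n
      block = lookup P

    ∈-block : ∀ v → v ∈ block v
    ∈-block = proj₁ (proj₁ (proj₁ P-max))

    block-≡ : ∀ v w → w ∈ block v → block w ≡ block v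
    block-≡ = proj₂ (proj₁ (proj₁ P-max))

    block-isClique : ∀ v → IsClique G (block v)
    block-isClique = proj₂ (proj₁ P-max)

    extend-block-isMaximalClique : ∀ v → IsMaximalClique G (extend (block v)) × v ∈ extend (block v)
    extend-block-isMaximalClique v =
      extend-isMaximalClique (block-isClique v) , ⊆-extend (block v) (∈-block v)

    extend-block-injective : ∀ v w → extend (block v) ≡ extend (block w) → block v ≡ block w
    extend-block-injective v w e with ≡-dec Bool._≟_ (block v) (block w)
    ... | yes v≡w = v≡w
    ... | no  v≢w = contradiction union-isClique (proj₂ P-max v w v≢w)
      where
      union⊆E : block v ∪ block w ⊆ extend (block v)
      union⊆E x∈ with x∈p∪q⁻ (block v) (block w) x∈
      ... | inj₁ x∈v = ⊆-extend (block v) x∈v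
      ... | inj₂ x∈w = subst (_ ∈_) (sym e) (⊆-extend (block w) x∈w)
      E-pw : PairwiseAdjacent (extend (block v))
      E-pw = proj₂ (proj₁ (proj₁ (extend-block-isMaximalClique v)))
      union-isClique : IsClique G (block v ∪ block w)
      union-isClique =
        (v , x∈p∪q⁺ (inj₁ (∈-block v))) ,
        λ x y x∈ y∈ → E-pw x y (union⊆E x∈) (union⊆E y∈)

  extend-blocks-injective : ∀ P Q → IsMaximalCliquePartition G P → IsMaximalCliquePartition G Q
                          → (∀ v → extend (lookup P v) ≡ extend (lookup Q v)) → P ≡ Q
  extend-blocks-injective P Q P-max Q-max E≡ = begin
    P                   ≡⟨ sym (tabulate∘lookup P) ⟩
    tabulate (lookup P) ≡⟨ tabulate-cong (λ v → ⊆-antisym (⊆-block P Q P-max Q-max E≡ v)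
                                                         (⊆-block Q P Q-max P-max (sym ∘ E≡) v)) ⟩
    tabulate (lookup Q) ≡⟨ tabulate∘lookup Q ⟩
    Q                   ∎
    where
    open ≡-Reasoning
    ⊆-block : ∀ P Q → IsMaximalCliquePartition G P → IsMaximalCliquePartition G Q
            → (∀ v → extend (lookup P v) ≡ extend (lookup Q v)) → ∀ v → lookup P v ⊆ lookup Q v
    ⊆-block P Q P-max Q-max E≡ v {w} w∈Pv =
      subst (w ∈_) Qw≡Qv (∈-block Q Q-max w)
      where
      Qw≡Qv : lookup Q w ≡ lookup Q v
      Qw≡Qv = extend-block-injective Q Q-max w v (begin
        extend (lookup Q w) ≡⟨ sym (E≡ w) ⟩
        extend (lookup P w) ≡⟨ cong extend (block-≡ P P-max v w w∈Pv) ⟩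
        extend (lookup P v) ≡⟨ E≡ v ⟩
        extend (lookup Q v) ∎)

theorem1 : (n : ℕ) (G : Graph n) (d : Fin n → ℕ)
           → (∀ v → HasSize (λ C → IsMaximalClique G C × v ∈ C) (d v))
           → (k : ℕ) → HasSize (IsMaximalCliquePartition G) k
           → k ≤ prod d
theorem1 n G d d-size k k-size = HasSize-≤ k-size code code-injective
  where
  choice : ∀ P → IsMaximalCliquePartition G P → (v : Fin n) → Fin (d v)
  choice P P-max v = position (d-size v) _ (extend-block-isMaximalClique G P P-max v)

  code : ∀ P → IsMaximalCliquePartition G P → Fin (prod d)
  code P P-max = encode (choice P P-max)

  code-injective : ∀ P Q (P-max : IsMaximalCliquePartition G P) (Q-max : IsMaximalCliquePartition G Q)
                 → code P P-max ≡ code Q Q-max → P ≡ Q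
  code-injective P Q P-max Q-max e = extend-blocks-injective G P Q P-max Q-max λ v →
    position-injective (d-size v) _ _ _ _ (encode-injective (choice P P-max) (choice Q Q-max) e v)
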